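{- Let $D_1,D_2$ be rulesets of a language $S$ such that $D_2$ emulates $D_1$ from $\emptyset$. If for every $D_1$-consistent cover $X$ of $S$ one has $\mathrm{Prov}_{D_1}(X)=X\cap F_S$, then for every $D_2$-consistent cover $X$ of $S$ one has $\mathrm{Prov}_{D_2}(X)=X\cap F_S$ (here $F_S$ is the set of formulas of $S$).
   Context: In a language $S$, formulas are built from atomic formulas using the NOR connective $\downarrow\varphi\psi$ and existential quantification; $\neg\varphi:=\downarrow\varphi\varphi$. A sequent is $(\Gamma,\varphi)$ with $\Gamma$ a finite set of formulas and $\varphi$ a formula; a rule maps sets of sequents to sets of sequents; a ruleset is a set of rules. $O_D(\Sigma)=\bigcup_{R\in D}R(\Sigma)$ with iterates $O^n_D$ ($O^0_D$ the identity); $X\vdash_D\varphi$ iff $(\Gamma,\varphi)\in O_D^n(\emptyset)$ for some $n$ and finite $\Gamma\subseteq X$; $\mathrm{Prov}_D(X)=\{\varphi:X\vdash_D\varphi\}$. $D_2$ emulates $D_1$ from $\emptyset$ if $\bigcup_{n\ge1}O^n_{D_1}(\emptyset)\subseteq\bigcup_{n\ge1}O^n_{D_2}(\emptyset)$. $X$ is $D$-consistent if there is no formula $\psi$ with $\psi,\neg\psi\in\mathrm{Prov}_D(X)$. $X$ is a cover of $S$ if for every formula $\varphi$, $\varphi\in X$ or $\neg\varphi\in X$. -}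

module Defs where

open import Data.Nat using (ℕ; zero; suc)
open import Data.List using (List)
open import Data.List.Relation.Unary.All using (All)
open import Data.Product using (Σ; _×_; ∃; ∃-syntax; _,_)
open import Data.Sum using (_⊎_)
open import Data.Empty using (⊥)
open import Level using (0ℓ)
open import Relation.Unary using (Pred; _⊆_; _∈_)

record Language : Set₁ where
  field
    Atom : Set
    Var  : Set
open Language public

-- Formulas of S (the set F_S): atomic, NOR ↓φψ, existential ∃x φ.
data Formula (S : Language) : Set where
  atom : Atom S → Formula S
  nor  : Formula S → Formula S → Formula S
  ex   : Var S → Formula S → Formula S

neg : ∀ {S} → Formula S → Formula S
neg φ = nor φ φ

FSet : Language → Set₁
FSet S = Pred (Formula S) 0ℓ

-- A sequent (Γ , φ); the finite set Γ is represented by a list.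
Sequent : Language → Set
Sequent S = List (Formula S) × Formula S

SeqSet : Language → Set₁
SeqSet S = Pred (Sequent S) 0ℓ

Rule : Language → Set₁
Rule S = SeqSet S → SeqSet S

record Ruleset (S : Language) : Set₁ where
  field
    Index : Set
    rule  : Index → Rule S
open Ruleset public

∅ : ∀ {S} → SeqSet S
∅ _ = ⊥

O : ∀ {S} → Ruleset S → SeqSet S → SeqSet S
O D Σs s = ∃[ i ] rule D i Σs s

O^ : ∀ {S} → Ruleset S → ℕ → SeqSet S → SeqSet S
O^ D zero    Σs = Σs
O^ D (suc n) Σs = O D (O^ D n Σs)

_⊢[_]_ : ∀ {S} → FSet S → Ruleset S → Formula S → Set
_⊢[_]_ {S} X D φ = ∃[ n ] ∃[ Γ ] (All (λ ψ → ψ ∈ X) Γ × O^ D n ∅ (Γ , φ))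

Prov : ∀ {S} → Ruleset S → FSet S → FSet S
Prov D X φ = X ⊢[ D ] φ

Emulates : ∀ {S} → Ruleset S → Ruleset S → Set
Emulates D₂ D₁ = ∀ s n → O^ D₁ (suc n) ∅ s → ∃[ m ] O^ D₂ (suc m) ∅ s

Consistent : ∀ {S} → Ruleset S → FSet S → Set
Consistent D X = ¬' (∃[ ψ ] (Prov D X ψ × Prov D X (neg ψ)))
  where ¬' : Set → Set
        ¬' A = A → ⊥

Cover : ∀ {S} → FSet S → Set
Cover X = ∀ φ → X φ ⊎ X (neg φ)

_≐_ : ∀ {S} → FSet S → FSet S → Set
A ≐ B = (A ⊆ B) × (B ⊆ A)

-- Emulation makes every D₁-derivation a D₂-derivation, so Prov D₁ X ⊆ Prov D₂ X.
-- Hence a D₂-consistent cover X is D₁-consistent, and the hypothesis gives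
-- X ⊆ Prov D₁ X ⊆ Prov D₂ X.  Conversely, if X ⊢ φ but φ ∉ X, then ¬φ ∈ X since
-- X is a cover, so X ⊢ ¬φ as well, contradicting D₂-consistency.
module Submission where

open import Defs
open import Data.Nat using (suc)
open import Data.Product using (_,_)
open import Data.Sum using (inj₁; inj₂)
open import Data.Empty using (⊥-elim)
open import Relation.Unary using (_⊆_)

module _ {S : Language} where

  Prov-mono-emulation : {D₁ D₂ : Ruleset S} → Emulates D₂ D₁ →
                        (X : FSet S) → Prov D₁ X ⊆ Prov D₂ X
  Prov-mono-emulation em X {φ} (suc n , Γ , Γ⊆X , d) with em (Γ , φ) n d
  ... | m , d′ = suc m , Γ , Γ⊆X , d′

  Consistent-antitone : {D₁ D₂ : Ruleset S} {X : FSet S} →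
                        Prov D₁ X ⊆ Prov D₂ X → Consistent D₂ X → Consistent D₁ X
  Consistent-antitone Prov₁⊆Prov₂ con (ψ , p , q) = con (ψ , Prov₁⊆Prov₂ p , Prov₁⊆Prov₂ q)

  Prov⊆cover : {D : Ruleset S} {X : FSet S} →
               X ⊆ Prov D X → Consistent D X → Cover X → Prov D X ⊆ X
  Prov⊆cover X⊆Prov con cov {φ} p with cov φ
  ... | inj₁ φ∈X  = φ∈X
  ... | inj₂ ¬φ∈X = ⊥-elim (con (φ , p , X⊆Prov ¬φ∈X))

mainTheorem16 : (S : Language) (D₁ D₂ : Ruleset S) →
    Emulates D₂ D₁ →
    ((X : FSet S) → Consistent D₁ X → Cover X → Prov D₁ X ≐ X) →
    (X : FSet S) → Consistent D₂ X → Cover X → Prov D₂ X ≐ X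
mainTheorem16 S D₁ D₂ em closed₁ X con₂ cov = Prov⊆cover X⊆Prov₂ con₂ cov , X⊆Prov₂
  where
    Prov₁⊆Prov₂ : Prov D₁ X ⊆ Prov D₂ X
    Prov₁⊆Prov₂ = Prov-mono-emulation em X

    X⊆Prov₂ : X ⊆ Prov D₂ X
    X⊆Prov₂ with closed₁ X (Consistent-antitone Prov₁⊆Prov₂ con₂) cov
    ... | _ , X⊆Prov₁ = λ φ∈X → Prov₁⊆Prov₂ (X⊆Prov₁ φ∈X)
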